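{- Let $c_1,\ldots,c_n$ be positive integers, $n\ge3$. Consider unknowns $x_{i,j}\in\mathbb{R}$, $i,j\in\{1,\ldots,n\}$, subject to the Ptolemy–Plücker relations $$x_{i,j}x_{k,\ell}=x_{i,k}x_{j,\ell}+x_{i,\ell}x_{k,j}\quad(i\le k\le j\le \ell),\qquad x_{i,i}=0,\qquad x_{i,i+1}=1,$$ together with the skew-symmetry condition $x_{i,j}=-x_{j,i}$ and the conditions $x_{i-1,i+1}=c_i$ for all $i$ (indices taken cyclically modulo $n$ in $\{1,\dots,n\}$). This system has a unique solution if and only if $M(c_1,\ldots,c_n)=\mathrm{Id}$.
   Context: $M(c_1,\ldots,c_n)=\prod_{i=1}^{n}\begin{pmatrix}c_i&-1\\1&0\end{pmatrix}$ (product from left to right in increasing index). The indices are thought of as the cyclically ordered vertices of a convex $n$-gon.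
   Formalization: The unknowns $x_{i,j}$ range over the rationals rather than the reals. -}

module Defs where

open import Data.Nat as ℕ using (ℕ; zero; suc; _+_)
open import Data.Nat.DivMod using (_%_; m%n<n)
open import Data.Fin as Fin using (Fin; toℕ; fromℕ<)
open import Data.Integer as ℤ using (ℤ)
open import Data.Rational as ℚ using (ℚ)
open import Relation.Binary.PropositionalEquality using (_≡_)
open import Data.Product using (_×_; Σ)
open import Function using (_∘_)

-- Vertices of the n-gon are Fin n = {0,…,n-1}, standing for {1,…,n}.
-- Cyclic successor i ↦ i+1 (mod n) and predecessor i ↦ i-1 (mod n).
next : ∀ {n} → Fin n → Fin n
next {suc m} i = fromℕ< (m%n<n (suc (toℕ i)) (suc m))

prev : ∀ {n} → Fin n → Fin n
prev {suc m} i = fromℕ< (m%n<n (toℕ i + m) (suc m))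

record Mat2 : Set where
  constructor mat
  field
    a b c d : ℤ

_·_ : Mat2 → Mat2 → Mat2
mat a b c d · mat a' b' c' d' =
  mat (a ℤ.* a' ℤ.+ b ℤ.* c') (a ℤ.* b' ℤ.+ b ℤ.* d')
      (c ℤ.* a' ℤ.+ d ℤ.* c') (c ℤ.* b' ℤ.+ d ℤ.* d')

Id : Mat2
Id = mat (ℤ.+ 1) (ℤ.+ 0) (ℤ.+ 0) (ℤ.+ 1)

E : ℕ → Mat2
E c = mat (ℤ.+ c) (ℤ.- ℤ.+ 1) (ℤ.+ 1) (ℤ.+ 0)

M : (n : ℕ) → (Fin n → ℕ) → Mat2
M zero    c = Id
M (suc n) c = E (c Fin.zero) · M n (c ∘ Fin.suc)

IsSolution : (n : ℕ) → (Fin n → ℕ) → (Fin n → Fin n → ℚ) → Set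
IsSolution n c x =
    (∀ i k j l → i Fin.≤ k → k Fin.≤ j → j Fin.≤ l →
       x i j ℚ.* x k l ≡ x i k ℚ.* x j l ℚ.+ x i l ℚ.* x k j)
  × (∀ i → x i i ≡ ℚ.0ℚ)
  × (∀ i → x i (next i) ≡ ℚ.1ℚ)
  × (∀ i j → x i j ≡ ℚ.- x j i)
  × (∀ i → x (prev i) (next i) ≡ (ℤ.+ c i) ℚ./ 1)

HasUniqueSolution : (n : ℕ) → (Fin n → ℕ) → Set
HasUniqueSolution n c =
  Σ (Fin n → Fin n → ℚ) λ x → IsSolution n c x ×
    (∀ y → IsSolution n c y → ∀ i j → y i j ≡ x i j)

{-# OPTIONS --safe #-}
module Submission where

-- Let row k be the first row of E(c k) ⋯ E(c (n-1)), with row n = e₁ and row (n+1) = e₂.  Then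
-- row k = c k · row (k+1) − row (k+2), consecutive rows span a unimodular frame, and M = Id says
-- exactly that row 0 = e₁ and row 1 = e₂.  Along each row of a solution, the Ptolemy relation on
-- a, k, k+1, k+2 is the same three-term recurrence x a (k+2) = c (k+1) · x a (k+1) − x a k, and
-- x a a = 0, x a (a+1) = 1, so every solution is x i j = det (row (i+1)) (row (j+1)), for any c.
-- Determinants satisfy all Plücker relations, and the three conditions that wrap around the
-- polygon, x (n-1) 0 = 1, x (n-1) 1 = c 0 and x (n-2) 0 = c (n-1), hold iff row 0 = e₁ and
-- row 1 = e₂.

open import Defs
open import Algebra.Bundles using (AbelianGroup)
import Algebra.Properties.Group as GroupProperties
open import Data.Fin as Fin using (Fin; toℕ; fromℕ<)
import Data.Fin.Properties as Fin
open import Data.Integer as ℤ using (ℤ; +_; -[1+_]; +[1+_])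
import Data.Integer.Properties as ℤ
open import Data.Integer.Tactic.RingSolver using (solve)
open import Data.List using (_∷_; [])
open import Data.Nat as ℕ using (ℕ; zero; suc; _≤_; _<_; z≤n; s≤s; z<s)
open import Data.Nat.DivMod
import Data.Nat.Coprimality as Coprimality
import Data.Nat.Properties as ℕ
open import Data.Product using (_×_; _,_)
open import Data.Rational as ℚ using (ℚ; mkℚ; ↥_)
import Data.Rational.Properties as ℚ
open import Data.Sum using (inj₁; inj₂)
open import Function using (_∘_; _∋_)
open import Function.Bundles using (_⇔_; mk⇔)
open import Relation.Binary.PropositionalEquality

fromℤ : ℤ → ℚ
fromℤ z = z ℚ./ 1

-- fromℤ normalises through a gcd; integral is the normal form itself, on which ℚ's operations compute.
integral : ℤ → ℚ
integral z = mkℚ z 0 (Coprimality.sym (Coprimality.1-coprimeTo ℤ.∣ z ∣))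

fromℤ≡integral : ∀ z → fromℤ z ≡ integral z
fromℤ≡integral z = ℚ.↥p/↧p≡p (integral z)

fromℤ-+ : ∀ a b → fromℤ a ℚ.+ fromℤ b ≡ fromℤ (a ℤ.+ b)
fromℤ-+ a b = trans (cong₂ ℚ._+_ (fromℤ≡integral a) (fromℤ≡integral b))
                    (cong fromℤ (cong₂ ℤ._+_ (ℤ.*-identityʳ a) (ℤ.*-identityʳ b)))

fromℤ-* : ∀ a b → fromℤ a ℚ.* fromℤ b ≡ fromℤ (a ℤ.* b)
fromℤ-* a b = cong₂ ℚ._*_ (fromℤ≡integral a) (fromℤ≡integral b)

fromℤ-neg : ∀ a → fromℤ (ℤ.- a) ≡ ℚ.- fromℤ a
fromℤ-neg a =
  trans (fromℤ≡integral (ℤ.- a)) (trans (integral-neg a) (cong ℚ.-_ (sym (fromℤ≡integral a))))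
  where
  integral-neg : ∀ a → integral (ℤ.- a) ≡ ℚ.- integral a
  integral-neg (+ 0)    = refl
  integral-neg +[1+ n ] = refl
  integral-neg -[1+ n ] = refl

fromℤ-injective : ∀ {a b} → fromℤ a ≡ fromℤ b → a ≡ b
fromℤ-injective {a} {b} eq =
  cong ↥_ (trans (sym (fromℤ≡integral a)) (trans eq (fromℤ≡integral b)))

Vec₂ : Set
Vec₂ = ℤ × ℤ

e₁ e₂ : Vec₂
e₁ = + 1 , + 0
e₂ = + 0 , + 1

module _ where
  open import Data.Integer.Base using (_+_; _*_; _-_; -_)

  det : Vec₂ → Vec₂ → ℤ
  det (a , b) (c , d) = a * d - b * c

  stepRow : ℤ → Vec₂ → Vec₂ → Vec₂
  stepRow k (a , b) (c , d) = k * a - c , k * b - d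

  det-self : ∀ u → det u u ≡ + 0
  det-self (a , b) = (a * b - b * a ≡ + 0) ∋ solve (a ∷ b ∷ [])

  det-antisym : ∀ u v → det u v ≡ - det v u
  det-antisym (a , b) (c , d) =
    (a * d - b * c ≡ - (c * b - d * a)) ∋ solve (a ∷ b ∷ c ∷ d ∷ [])

  det-plücker : ∀ u v w z → det u w * det v z ≡ det u v * det w z + det u z * det v w
  det-plücker (a , b) (c , d) (e , f) (g , h) =
    ((a * f - b * e) * (c * h - d * g) ≡
       (a * d - b * c) * (e * h - f * g) + (a * h - b * g) * (c * f - d * e))
    ∋ solve (a ∷ b ∷ c ∷ d ∷ e ∷ f ∷ g ∷ h ∷ [])

  det-stepRowˡ : ∀ k u w → det (stepRow k u w) u ≡ det u w
  det-stepRowˡ k (a , b) (c , d) =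
    ((k * a - c) * b - (k * b - d) * a ≡ a * d - b * c)
    ∋ solve (k ∷ a ∷ b ∷ c ∷ d ∷ [])

  det-stepRow-last : ∀ k u w → det (stepRow k u w) w ≡ k * det u w
  det-stepRow-last k (a , b) (c , d) =
    ((k * a - c) * d - (k * b - d) * c ≡ k * (a * d - b * c))
    ∋ solve (k ∷ a ∷ b ∷ c ∷ d ∷ [])

  det-stepRowʳ : ∀ u k v w → det u (stepRow k v w) + det u w ≡ det u v * k
  det-stepRowʳ (a , b) k (c , d) (e , f) =
    ((a * (k * d - f) - b * (k * c - e)) + (a * f - b * e) ≡ (a * d - b * c) * k)
    ∋ solve (a ∷ b ∷ k ∷ c ∷ d ∷ e ∷ f ∷ [])

  dets⇒≡e₂ : ∀ k u → det e₁ u ≡ + 1 → det (stepRow k e₁ e₂) u ≡ k → u ≡ e₂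
  dets⇒≡e₂ k (p , q) h₁ h₂ with trans ((q ≡ + 1 * q - + 0 * p) ∋ solve (p ∷ q ∷ [])) h₁
  ... | refl = cong (_, + 1) (+-identityʳ-unique k p (trans k+p≡det h₂))
    where
    open GroupProperties (AbelianGroup.group ℤ.+-0-abelianGroup)
      renaming (identityʳ-unique to +-identityʳ-unique)
    k+p≡det : k + p ≡ (k * + 1 - + 0) * + 1 - (k * + 0 - + 1) * p
    k+p≡det = solve (k ∷ p ∷ [])

  dets⇒stepRow-e₂≡e₁ : ∀ k w → det e₁ w ≡ k → det e₂ w ≡ + 1 → stepRow k e₂ w ≡ e₁
  dets⇒stepRow-e₂≡e₁ k (s , t) h₁ h₂
    with trans ((t ≡ + 1 * t - + 0 * s) ∋ solve (s ∷ t ∷ [])) h₁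
       | trans ((s ≡ - (+ 0 * t - + 1 * s)) ∋ solve (s ∷ t ∷ [])) (cong -_ h₂)
  ... | refl | refl = cong₂ _,_ ((k * + 0 - - + 1 ≡ + 1) ∋ solve (k ∷ []))
                                ((k * + 1 - k ≡ + 0) ∋ solve (k ∷ []))

fromRows : Vec₂ → Vec₂ → Mat2
fromRows (a , b) (c , d) = mat a b c d

firstRow secondRow : Mat2 → Vec₂
firstRow  (mat a b _ _) = a , b
secondRow (mat _ _ c d) = c , d

E·fromRows : ∀ k u w → E k · fromRows u w ≡ fromRows (stepRow (+ k) u w) u
E·fromRows k (a , b) (c , d) = elementary·fromRows (+ k)
  where
  open import Data.Integer.Base using (_+_; _*_; _-_; -_)
  -- Generalised from + k to an integer K because the ring solver only abstracts variables.
  elementary·fromRows : ∀ K →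
    mat K (- + 1) (+ 1) (+ 0) · mat a b c d ≡ mat (K * a - c) (K * b - d) a b
  elementary·fromRows K = cong₂ fromRows
    (cong₂ _,_ ((K * a + - + 1 * c ≡ K * a - c) ∋ solve (K ∷ a ∷ c ∷ []))
               ((K * b + - + 1 * d ≡ K * b - d) ∋ solve (K ∷ b ∷ d ∷ [])))
    (cong₂ _,_ ((+ 1 * a + + 0 * c ≡ a) ∋ solve (a ∷ c ∷ []))
               ((+ 1 * b + + 0 * d ≡ b) ∋ solve (b ∷ d ∷ [])))

-- For k ≤ n, row n c k and row n c (suc k) are the two rows of E (c k) ⋯ E (c (n-1)); larger k are junk.
row : (n : ℕ) → (Fin n → ℕ) → ℕ → Vec₂
row zero    c 0             = e₁
row zero    c 1             = e₂
row zero    c (suc (suc k)) = + 0 , + 0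
row (suc n) c zero          = stepRow (+ c Fin.zero) (row n (c ∘ Fin.suc) 0) (row n (c ∘ Fin.suc) 1)
row (suc n) c (suc k)       = row n (c ∘ Fin.suc) k

M≡fromRows : ∀ n c → M n c ≡ fromRows (row n c 0) (row n c 1)
M≡fromRows zero    c = refl
M≡fromRows (suc n) c =
  trans (cong (E (c Fin.zero) ·_) (M≡fromRows n (c ∘ Fin.suc))) (E·fromRows (c Fin.zero) _ _)

row-recurrence : ∀ n c k (k<n : k < n) →
  row n c k ≡ stepRow (+ c (fromℕ< k<n)) (row n c (suc k)) (row n c (suc (suc k)))
row-recurrence (suc n) c zero    _         = refl
row-recurrence (suc n) c (suc k) (s≤s k<n) = row-recurrence n (c ∘ Fin.suc) k k<n

row-last : ∀ n c → row n c n ≡ e₁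
row-last zero    c = refl
row-last (suc n) c = row-last n (c ∘ Fin.suc)

row-afterLast : ∀ n c → row n c (suc n) ≡ e₂
row-afterLast zero    c = refl
row-afterLast (suc n) c = row-afterLast n (c ∘ Fin.suc)

det-row-suc : ∀ n c k → k ≤ n → det (row n c k) (row n c (suc k)) ≡ + 1
det-row-suc zero    c zero    _         = refl
det-row-suc (suc n) c zero    _         =
  trans (det-stepRowˡ (+ c Fin.zero) (row n (c ∘ Fin.suc) 0) (row n (c ∘ Fin.suc) 1))
        (det-row-suc n (c ∘ Fin.suc) 0 z≤n)
det-row-suc (suc n) c (suc k) (s≤s k≤n) = det-row-suc n (c ∘ Fin.suc) k k≤n

det-row-2+ : ∀ n c k (k<n : k < n) → det (row n c k) (row n c (suc (suc k))) ≡ + c (fromℕ< k<n)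
det-row-2+ n c k k<n = begin
  det (R k) (R (suc (suc k)))
    ≡⟨ cong (λ r → det r (R (suc (suc k)))) (row-recurrence n c k k<n) ⟩
  det (stepRow cₖ (R (suc k)) (R (suc (suc k)))) (R (suc (suc k)))
    ≡⟨ det-stepRow-last cₖ (R (suc k)) (R (suc (suc k))) ⟩
  cₖ ℤ.* det (R (suc k)) (R (suc (suc k)))
    ≡⟨ cong (cₖ ℤ.*_) (det-row-suc n c (suc k) k<n) ⟩
  cₖ ℤ.* + 1
    ≡⟨ ℤ.*-identityʳ cₖ ⟩
  cₖ ∎
  where
  open ≡-Reasoning
  R = row n c
  cₖ = + c (fromℕ< k<n)

[m+n%d]%d≡[m+n]%d : ∀ m n d .{{_ : ℕ.NonZero d}} → (m ℕ.+ n % d) % d ≡ (m ℕ.+ n) % d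
[m+n%d]%d≡[m+n]%d m n d = begin
  (m ℕ.+ n % d) % d           ≡⟨ %-distribˡ-+ m (n % d) d ⟩
  (m % d ℕ.+ n % d % d) % d   ≡⟨ cong (λ r → (m % d ℕ.+ r) % d) (m%n%n≡m%n n d) ⟩
  (m % d ℕ.+ n % d) % d       ≡⟨ %-distribˡ-+ m n d ⟨
  (m ℕ.+ n) % d               ∎
  where open ≡-Reasoning

%≡⇒mod≡ : ∀ a b {n} .{{_ : ℕ.NonZero n}} → a % n ≡ b % n → a mod n ≡ b mod n
%≡⇒mod≡ a b eq = Fin.fromℕ<-cong (a % _) (b % _) eq _ _

mod≡fromℕ< : ∀ {a n} .{{_ : ℕ.NonZero n}} (a<n : a < n) → a mod n ≡ fromℕ< a<n
mod≡fromℕ< {a} a<n = Fin.fromℕ<-cong (a % _) a (m<n⇒m%n≡m a<n) _ _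

toℕ-mod : ∀ a n .{{_ : ℕ.NonZero n}} → toℕ (a mod n) ≡ a % n
toℕ-mod a n = Fin.toℕ-fromℕ< _

toℕ-mod-< : ∀ {a n} .{{_ : ℕ.NonZero n}} → a < n → toℕ (a mod n) ≡ a
toℕ-mod-< {a} {n} a<n = trans (toℕ-mod a n) (m<n⇒m%n≡m a<n)

mod-toℕ : ∀ {n} (i : Fin (suc n)) → toℕ i mod suc n ≡ i
mod-toℕ i = trans (mod≡fromℕ< (Fin.toℕ<n i)) (Fin.fromℕ<-toℕ i _)

mod-mono-≤ : ∀ {a b n} .{{_ : ℕ.NonZero n}} → a ≤ b → b < n → a mod n Fin.≤ b mod n
mod-mono-≤ a≤b b<n =
  subst₂ _≤_ (sym (toℕ-mod-< (ℕ.≤-<-trans a≤b b<n))) (sym (toℕ-mod-< b<n)) a≤b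

next-mod : ∀ {m} a → next (a mod suc m) ≡ suc a mod suc m
next-mod {m} a = %≡⇒mod≡ (suc (toℕ (a mod n))) (suc a) (begin
  suc (toℕ (a mod n)) % n  ≡⟨ cong (λ r → suc r % n) (toℕ-mod a n) ⟩
  (1 ℕ.+ a % n) % n        ≡⟨ [m+n%d]%d≡[m+n]%d 1 a n ⟩
  suc a % n                ∎)
  where
  open ≡-Reasoning
  n = suc m

prev-mod : ∀ {m} a → prev (suc a mod suc m) ≡ a mod suc m
prev-mod {m} a = %≡⇒mod≡ (toℕ (suc a mod n) ℕ.+ m) a (begin
  (toℕ (suc a mod n) ℕ.+ m) % n  ≡⟨ cong (λ r → (r ℕ.+ m) % n) (toℕ-mod (suc a) n) ⟩
  (suc a % n ℕ.+ m) % n          ≡⟨ cong (_% n) (ℕ.+-comm (suc a % n) m) ⟩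
  (m ℕ.+ suc a % n) % n          ≡⟨ [m+n%d]%d≡[m+n]%d m (suc a) n ⟩
  (m ℕ.+ suc a) % n              ≡⟨ cong (_% n) (trans (ℕ.+-comm m (suc a)) (sym (ℕ.+-suc a m))) ⟩
  (a ℕ.+ n) % n                  ≡⟨ [m+n]%n≡m%n a n ⟩
  a % n                          ∎)
  where
  open ≡-Reasoning
  n = suc m

cyclic : ∀ {m} → (Fin (suc m) → Fin (suc m) → ℚ) → ℕ → ℕ → ℚ
cyclic {m} y a b = y (a mod suc m) (b mod suc m)

cyclic-toℕ : ∀ {m} (y : Fin (suc m) → Fin (suc m) → ℚ) i j → cyclic y (toℕ i) (toℕ j) ≡ y i j
cyclic-toℕ y i j = cong₂ y (mod-toℕ i) (mod-toℕ j)

cyclic-periodicʳ : ∀ {m} (y : Fin (suc m) → Fin (suc m) → ℚ) a b →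
  cyclic y a (b ℕ.+ suc m) ≡ cyclic y a b
cyclic-periodicʳ {m} y a b = cong (y _) (%≡⇒mod≡ (b ℕ.+ suc m) b ([m+n]%n≡m%n b (suc m)))

-- Vertex a sits at row (suc a), so that x (a-1) (a+1) = det (row a) (row (a+2)) = c a.
frieze : (n : ℕ) → (Fin n → ℕ) → ℕ → ℕ → ℚ
frieze n c a b = fromℤ (det (row n c (suc a)) (row n c (suc b)))

module _ (n : ℕ) (c : Fin n → ℕ) where

  frieze-diag : ∀ a → frieze n c a a ≡ ℚ.0ℚ
  frieze-diag a = cong fromℤ (det-self (row n c (suc a)))

  frieze-next : ∀ a → a < n → frieze n c a (suc a) ≡ ℚ.1ℚ
  frieze-next a a<n = cong fromℤ (det-row-suc n c (suc a) a<n)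

  frieze-antisym : ∀ a b → frieze n c a b ≡ ℚ.- frieze n c b a
  frieze-antisym a b = trans (cong fromℤ (det-antisym A B)) (fromℤ-neg (det B A))
    where
    A = row n c (suc a)
    B = row n c (suc b)

  frieze-ptolemy : ∀ a b k l →
    frieze n c a k ℚ.* frieze n c b l
      ≡ frieze n c a b ℚ.* frieze n c k l ℚ.+ frieze n c a l ℚ.* frieze n c b k
  frieze-ptolemy a b k l = begin
    fromℤ (det A K) ℚ.* fromℤ (det B L)
      ≡⟨ fromℤ-* (det A K) (det B L) ⟩
    fromℤ (det A K ℤ.* det B L)
      ≡⟨ cong fromℤ (det-plücker A B K L) ⟩
    fromℤ (det A B ℤ.* det K L ℤ.+ det A L ℤ.* det B K)
      ≡⟨ fromℤ-+ (det A B ℤ.* det K L) (det A L ℤ.* det B K) ⟨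
    fromℤ (det A B ℤ.* det K L) ℚ.+ fromℤ (det A L ℤ.* det B K)
      ≡⟨ cong₂ ℚ._+_ (fromℤ-* (det A B) (det K L)) (fromℤ-* (det A L) (det B K)) ⟨
    fromℤ (det A B) ℚ.* fromℤ (det K L) ℚ.+ fromℤ (det A L) ℚ.* fromℤ (det B K) ∎
    where
    open ≡-Reasoning
    A = row n c (suc a)
    B = row n c (suc b)
    K = row n c (suc k)
    L = row n c (suc l)

  frieze-recurrence : ∀ a k (1+k<n : suc k < n) →
    frieze n c a (suc k) ℚ.* fromℤ (+ c (fromℕ< 1+k<n))
      ≡ frieze n c a k ℚ.+ frieze n c a (suc (suc k))
  frieze-recurrence a k 1+k<n = begin
    fromℤ (det u v) ℚ.* fromℤ cₖ₊₁
      ≡⟨ fromℤ-* (det u v) cₖ₊₁ ⟩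
    fromℤ (det u v ℤ.* cₖ₊₁)
      ≡⟨ cong fromℤ (det-stepRowʳ u cₖ₊₁ v w) ⟨
    fromℤ (det u (stepRow cₖ₊₁ v w) ℤ.+ det u w)
      ≡⟨ cong (λ r → fromℤ (det u r ℤ.+ det u w)) (row-recurrence n c (suc k) 1+k<n) ⟨
    fromℤ (det u (row n c (suc k)) ℤ.+ det u w)
      ≡⟨ fromℤ-+ (det u (row n c (suc k))) (det u w) ⟨
    fromℤ (det u (row n c (suc k))) ℚ.+ fromℤ (det u w) ∎
    where
    open ≡-Reasoning
    u = row n c (suc a)
    v = row n c (suc (suc k))
    w = row n c (suc (suc (suc k)))
    cₖ₊₁ = + c (fromℕ< 1+k<n)

module _ {m} (c : Fin (suc m) → ℕ) {y : Fin (suc m) → Fin (suc m) → ℚ}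
         (y-sol : IsSolution (suc m) c y) where
  private
    n = suc m
    Y = cyclic y

  solution-diag : ∀ a → Y a a ≡ ℚ.0ℚ
  solution-diag a = let (_ , diag , _) = y-sol in diag (a mod n)

  solution-next : ∀ a → Y a (suc a) ≡ ℚ.1ℚ
  solution-next a = let (_ , _ , next≡1 , _) = y-sol in
    trans (cong (y _) (sym (next-mod a))) (next≡1 (a mod n))

  solution-skip : ∀ a → Y a (suc (suc a)) ≡ fromℤ (+ c (suc a mod n))
  solution-skip a = let (_ , _ , _ , _ , skip) = y-sol in
    trans (cong₂ y (sym (prev-mod a)) (sym (next-mod (suc a)))) (skip (suc a mod n))

  solution-antisym : ∀ a b → Y a b ≡ ℚ.- Y b a
  solution-antisym a b = let (_ , _ , _ , antisym , _) = y-sol in antisym (a mod n) (b mod n)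

  solution-recurrence : ∀ a k → a ≤ k → suc (suc k) < n →
    Y a (suc k) ℚ.* fromℤ (+ c (suc k mod n)) ≡ Y a k ℚ.+ Y a (suc (suc k))
  solution-recurrence a k a≤k 2+k<n = let (ptolemy , _) = y-sol in begin
    Y a (suc k) ℚ.* fromℤ (+ c (suc k mod n))
      ≡⟨ cong (Y a (suc k) ℚ.*_) (solution-skip k) ⟨
    Y a (suc k) ℚ.* Y k (suc (suc k))
      ≡⟨ ptolemy (a mod n) (k mod n) (suc k mod n) (suc (suc k) mod n)
                 (mod-mono-≤ a≤k k<n) (mod-mono-≤ (ℕ.n≤1+n k) 1+k<n)
                 (mod-mono-≤ (ℕ.n≤1+n (suc k)) 2+k<n) ⟩
    Y a k ℚ.* Y (suc k) (suc (suc k)) ℚ.+ Y a (suc (suc k)) ℚ.* Y k (suc k)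
      ≡⟨ cong₂ ℚ._+_ (*-next (Y a k) (suc k)) (*-next (Y a (suc (suc k))) k) ⟩
    Y a k ℚ.+ Y a (suc (suc k)) ∎
    where
    open ≡-Reasoning
    1+k<n = ℕ.<-trans (ℕ.n<1+n (suc k)) 2+k<n
    k<n   = ℕ.<-trans (ℕ.n<1+n k) 1+k<n
    *-next : ∀ q b → q ℚ.* Y b (suc b) ≡ q
    *-next q b = trans (cong (q ℚ.*_) (solution-next b)) (ℚ.*-identityʳ q)

  -- Indexed by d + a, not a + d, so that suc (d + a) ≡ suc d + a holds definitionally.
  solution≡frieze-on-arc : ∀ a d → d ℕ.+ a < n → Y a (d ℕ.+ a) ≡ frieze n c a (d ℕ.+ a)
  solution≡frieze-on-arc a zero          _     =
    trans (solution-diag a) (sym (frieze-diag n c a))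
  solution≡frieze-on-arc a (suc zero)    1+a<n =
    trans (solution-next a) (sym (frieze-next n c a (ℕ.<⇒≤ 1+a<n)))
  solution≡frieze-on-arc a (suc (suc d)) 2+k<n = +-cancelˡ (Y a k) _ _ (begin
    Y a k ℚ.+ Y a (suc (suc k))
      ≡⟨ solution-recurrence a k (ℕ.m≤n+m a d) 2+k<n ⟨
    Y a (suc k) ℚ.* cₖ₊₁
      ≡⟨ cong (ℚ._* cₖ₊₁) (solution≡frieze-on-arc a (suc d) 1+k<n) ⟩
    frieze n c a (suc k) ℚ.* cₖ₊₁
      ≡⟨ cong (λ i → frieze n c a (suc k) ℚ.* fromℤ (+ c i)) (mod≡fromℕ< 1+k<n) ⟩
    frieze n c a (suc k) ℚ.* fromℤ (+ c (fromℕ< 1+k<n))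
      ≡⟨ frieze-recurrence n c a k 1+k<n ⟩
    frieze n c a k ℚ.+ frieze n c a (suc (suc k))
      ≡⟨ cong (ℚ._+ frieze n c a (suc (suc k))) (solution≡frieze-on-arc a d k<n) ⟨
    Y a k ℚ.+ frieze n c a (suc (suc k)) ∎)
    where
    open ≡-Reasoning
    open GroupProperties ℚ.+-0-group renaming (∙-cancelˡ to +-cancelˡ)
    k     = d ℕ.+ a
    cₖ₊₁  = fromℤ (+ c (suc k mod n))
    1+k<n = ℕ.<-trans (ℕ.n<1+n (suc k)) 2+k<n
    k<n   = ℕ.<-trans (ℕ.n<1+n k) 1+k<n

  solution≡frieze-≤ : ∀ {a b} → a ≤ b → b < n → Y a b ≡ frieze n c a b
  solution≡frieze-≤ {a} {b} a≤b b<n =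
    subst (λ b → Y a b ≡ frieze n c a b) (ℕ.m∸n+n≡m a≤b)
      (solution≡frieze-on-arc a (b ℕ.∸ a) (subst (_< n) (sym (ℕ.m∸n+n≡m a≤b)) b<n))

  solution≡frieze : ∀ i j → y i j ≡ frieze n c (toℕ i) (toℕ j)
  solution≡frieze i j with ℕ.≤-total (toℕ i) (toℕ j)
  ... | inj₁ i≤j = trans (sym (cyclic-toℕ y i j)) (solution≡frieze-≤ i≤j (Fin.toℕ<n j))
  ... | inj₂ j≤i = begin
    y i j                              ≡⟨ cyclic-toℕ y i j ⟨
    Y (toℕ i) (toℕ j)                  ≡⟨ solution-antisym (toℕ i) (toℕ j) ⟩
    ℚ.- Y (toℕ j) (toℕ i)              ≡⟨ cong ℚ.-_ (solution≡frieze-≤ j≤i (Fin.toℕ<n i)) ⟩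
    ℚ.- frieze n c (toℕ j) (toℕ i)     ≡⟨ frieze-antisym n c (toℕ i) (toℕ j) ⟨
    frieze n c (toℕ i) (toℕ j)         ∎
    where open ≡-Reasoning

  solution-wrap : ∀ {a b} → b ≤ a → a < n → Y a (b ℕ.+ n) ≡ frieze n c a b
  solution-wrap {a} {b} b≤a a<n = begin
    Y a (b ℕ.+ n)        ≡⟨ cyclic-periodicʳ y a b ⟩
    Y a b                ≡⟨ solution-antisym a b ⟩
    ℚ.- Y b a            ≡⟨ cong ℚ.-_ (solution≡frieze-≤ b≤a a<n) ⟩
    ℚ.- frieze n c b a   ≡⟨ frieze-antisym n c a b ⟨
    frieze n c a b       ∎
    where open ≡-Reasoning

module _ {m} (c : Fin (suc m) → ℕ) (M≡Id : M (suc m) c ≡ Id) where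
  private
    n = suc m
    R = row n c
    fromRows≡Id = trans (sym (M≡fromRows n c)) M≡Id

  row-0≡e₁ : R 0 ≡ e₁
  row-0≡e₁ = cong firstRow fromRows≡Id

  row-1≡e₂ : R 1 ≡ e₂
  row-1≡e₂ = cong secondRow fromRows≡Id

  row-suc-% : ∀ a → a ≤ n → R (suc (a % n)) ≡ R (suc a)
  row-suc-% a a≤n with ℕ.m≤n⇒m<n∨m≡n a≤n
  ... | inj₁ a<n  = cong (R ∘ suc) (m<n⇒m%n≡m a<n)
  ... | inj₂ refl = trans (cong (R ∘ suc) (n%n≡0 n)) (trans row-1≡e₂ (sym (row-afterLast n c)))

  row-next : ∀ (i : Fin n) → R (suc (toℕ (next i))) ≡ R (suc (suc (toℕ i)))
  row-next i = trans (cong (R ∘ suc) (toℕ-mod (suc (toℕ i)) n))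
                     (row-suc-% (suc (toℕ i)) (Fin.toℕ<n i))

  row-prev : ∀ (i : Fin n) → R (suc (toℕ (prev i))) ≡ R (toℕ i)
  row-prev Fin.zero    = begin
    R (suc (toℕ (m mod n)))  ≡⟨ cong (R ∘ suc) (toℕ-mod-< (ℕ.n<1+n m)) ⟩
    R n                      ≡⟨ row-last n c ⟩
    e₁                       ≡⟨ row-0≡e₁ ⟨
    R 0                      ∎
    where open ≡-Reasoning
  row-prev (Fin.suc j) = cong (R ∘ suc) (begin
    toℕ (prev (Fin.suc j))              ≡⟨ cong (toℕ ∘ prev) (mod-toℕ (Fin.suc j)) ⟨
    toℕ (prev (suc (toℕ j) mod n))      ≡⟨ cong toℕ (prev-mod (toℕ j)) ⟩
    toℕ (toℕ j mod n)                   ≡⟨ toℕ-mod-< (ℕ.m<n⇒m<1+n (Fin.toℕ<n j)) ⟩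
    toℕ j                               ∎)
    where open ≡-Reasoning

  frieze-isSolution : IsSolution n c (λ i j → frieze n c (toℕ i) (toℕ j))
  frieze-isSolution =
      (λ i k j l _ _ _ → frieze-ptolemy n c (toℕ i) (toℕ k) (toℕ j) (toℕ l))
    , (λ i → frieze-diag n c (toℕ i))
    , (λ i → cong fromℤ (trans (cong (det (R (suc (toℕ i)))) (row-next i))
                               (det-row-suc n c (suc (toℕ i)) (Fin.toℕ<n i))))
    , (λ i j → frieze-antisym n c (toℕ i) (toℕ j))
    , (λ i → cong fromℤ (begin
        det (R (suc (toℕ (prev i)))) (R (suc (toℕ (next i))))
          ≡⟨ cong₂ det (row-prev i) (row-next i) ⟩
        det (R (toℕ i)) (R (suc (suc (toℕ i))))
          ≡⟨ det-row-2+ n c (toℕ i) (Fin.toℕ<n i) ⟩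
        + c (fromℕ< (Fin.toℕ<n i))
          ≡⟨ cong (+_ ∘ c) (Fin.fromℕ<-toℕ i _) ⟩
        + c i ∎))
    where open ≡-Reasoning

frieze-wraps⇒M≡Id : ∀ {m} (c : Fin (suc (suc m)) → ℕ) → let n = suc (suc m) in
  frieze n c (suc m) 0 ≡ ℚ.1ℚ →
  frieze n c (suc m) 1 ≡ fromℤ (+ c Fin.zero) →
  frieze n c m 0 ≡ fromℤ (+ c (suc m mod n)) →
  M n c ≡ Id
frieze-wraps⇒M≡Id {m} c wrap₁ wrap₂ wrap₃ = begin
  M n c                  ≡⟨ M≡fromRows n c ⟩
  fromRows (R 0) (R 1)   ≡⟨ cong₂ fromRows R0≡e₁ R1≡e₂ ⟩
  fromRows e₁ e₂         ∎
  where
  open ≡-Reasoning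
  n    = suc (suc m)
  R    = row n c
  cₙ₋₁ = + c (suc m mod n)

  R-penultimate : R (suc m) ≡ stepRow cₙ₋₁ e₁ e₂
  R-penultimate = begin
    R (suc m)
      ≡⟨ row-recurrence n c (suc m) ℕ.≤-refl ⟩
    stepRow cₙ₋₁' (R n) (R (suc n))
      ≡⟨ cong₂ (stepRow cₙ₋₁') (row-last n c) (row-afterLast n c) ⟩
    stepRow cₙ₋₁' e₁ e₂
      ≡⟨ cong (λ i → stepRow (+ c i) e₁ e₂) (mod≡fromℕ< ℕ.≤-refl) ⟨
    stepRow cₙ₋₁ e₁ e₂ ∎
    where cₙ₋₁' = + c (fromℕ< ℕ.≤-refl)

  R1≡e₂ : R 1 ≡ e₂
  R1≡e₂ = dets⇒≡e₂ cₙ₋₁ (R 1)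
    (subst (λ r → det r (R 1) ≡ + 1) (row-last n c) (fromℤ-injective wrap₁))
    (subst (λ r → det r (R 1) ≡ cₙ₋₁) R-penultimate (fromℤ-injective wrap₃))

  R0≡e₁ : R 0 ≡ e₁
  R0≡e₁ = begin
    R 0                    ≡⟨ row-recurrence n c 0 z<s ⟩
    stepRow c₀ (R 1) (R 2) ≡⟨ cong (λ u → stepRow c₀ u (R 2)) R1≡e₂ ⟩
    stepRow c₀ e₂ (R 2)    ≡⟨ dets⇒stepRow-e₂≡e₁ c₀ (R 2) e₁-R2 e₂-R2 ⟩
    e₁                     ∎
    where
    c₀ = + c Fin.zero
    e₁-R2 : det e₁ (R 2) ≡ c₀
    e₁-R2 = subst (λ r → det r (R 2) ≡ c₀) (row-last n c) (fromℤ-injective wrap₂)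
    e₂-R2 : det e₂ (R 2) ≡ + 1
    e₂-R2 = subst (λ r → det r (R 2) ≡ + 1) R1≡e₂ (det-row-suc n c 1 (s≤s z≤n))

solution⇒M≡Id : ∀ {m} (c : Fin (suc (suc m)) → ℕ) {y} →
  IsSolution (suc (suc m)) c y → M (suc (suc m)) c ≡ Id
solution⇒M≡Id {m} c y-sol = frieze-wraps⇒M≡Id c
  (trans (sym (solution-wrap c y-sol z≤n ℕ.≤-refl)) (solution-next c y-sol (suc m)))
  (trans (sym (solution-wrap c y-sol (s≤s z≤n) ℕ.≤-refl))
         (trans (solution-skip c y-sol (suc m)) (cong (fromℤ ∘ +_ ∘ c) (%≡⇒mod≡ n 0 (n%n≡0 n)))))
  (trans (sym (solution-wrap c y-sol z≤n (ℕ.m<n⇒m<1+n (ℕ.n<1+n m)))) (solution-skip c y-sol m))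
  where n = suc (suc m)

theorem5p7 : (n : ℕ) → 3 ≤ n → (c : Fin n → ℕ) → (∀ i → 1 ≤ c i) →
    HasUniqueSolution n c ⇔ (M n c ≡ Id)
theorem5p7 (suc (suc (suc k))) (s≤s (s≤s (s≤s z≤n))) c _ = mk⇔
  (λ (_ , y-sol , _) → solution⇒M≡Id c y-sol)
  (λ M≡Id → _ , frieze-isSolution c M≡Id , λ _ y-sol → solution≡frieze c y-sol)
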